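{- Let $G$ be a finite simple graph that is $\chi$-critical (i.e. $\chi(G-v)<\chi(G)$ for every $v\in V(G)$) and Chair-free, and write $\chi=\chi(G)$. Consider all triples $(u,C,(\alpha_1,\dots,\alpha_m))$ where $u\in V(G)$, $C$ is a proper $(\chi-1)$-coloring of $G-u$, and $\alpha_1,\dots,\alpha_m$ is an enumeration of the colors that appear on at least two vertices of $N(u)$; for such a triple let $R=\{x\in N(u): \text{the color } C(x) \text{ appears on no other vertex of } N(u)\}$ and let $N_i$ be the number of vertices of $N(u)$ colored $\alpha_i$. Fix a triple which first maximizes $|R|$, then (among those) minimizes $N_1$, then minimizes $N_2$, and so on. Then $m=\chi-|R|-1$ and: (A) every $x\in R$ has, for every $i\in\{1,\dots,\chi-|R|-1\}$, a neighbor in $N(u)$ colored $\alpha_i$; (B) every vertex $y\in N(u)\setminus R$ colored $\alpha_i$ has, for every $k>i$ with $k\le \chi-|R|-1$, a neighbor in $N(u)$ colored $\alpha_k$.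
   Context: All graphs are finite and simple. $N(u)$ is the set of neighbors of $u$. The Chair (also called fork) is the graph on five vertices $c,a,b,d,e$ with edges $ca,cb,cd,de$. A graph is $H$-free if it has no induced subgraph isomorphic to $H$; it is $\{H_1,\dots,H_k\}$-free if it is $H_i$-free for every $i$. -}

module Defs where

open import Data.Nat using (ℕ; zero; suc; _<_; _≡ᵇ_)
open import Data.Fin using (Fin)
open import Data.Fin.Properties using (_≟_)
open import Data.Bool using (Bool; true; false; _∧_; not; if_then_else_)
open import Data.List using (List; []; _∷_; length; lookup; map)
open import Data.List.Relation.Unary.Any using (any?)
open import Data.List.Relation.Unary.Unique.Propositional using (Unique)
open import Data.List.Membership.Propositional using (_∈_)
open import Data.Product using (Σ; _×_; ∃; ∃-syntax)
open import Data.Sum using (_⊎_)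
open import Data.List using (allFin)
import Data.Fin as Fin
open import Relation.Nullary using (¬_; does)
open import Relation.Binary.PropositionalEquality using (_≡_; _≢_)
open import Function.Bundles using (_⇔_)

record Graph : Set where
  field
    n     : ℕ
    adj   : Fin n → Fin n → Bool
    sym   : ∀ x y → adj x y ≡ adj y x
    irref : ∀ x → adj x x ≡ false
open Graph public

Vertex : Graph → Set
Vertex G = Fin (n G)

Adj : (G : Graph) → Vertex G → Vertex G → Set
Adj G x y = adj G x y ≡ true

-- A proper k-colouring of G[S] is a map c (values outside S are
-- irrelevant) with c x < k for x ∈ S and c x ≢ c y for adjacent x,y ∈ S.

ProperColoringOn : (G : Graph) → (Vertex G → Set) → ℕ → (Vertex G → ℕ) → Set
ProperColoringOn G S k c =
  (∀ x → S x → c x < k) ×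
  (∀ x y → S x → S y → Adj G x y → c x ≢ c y)

ColorableOn : (G : Graph) → (Vertex G → Set) → ℕ → Set
ColorableOn G S k = Σ (Vertex G → ℕ) (ProperColoringOn G S k)

ChromaticNumberOn : (G : Graph) → (Vertex G → Set) → ℕ → Set
ChromaticNumberOn G S k = ColorableOn G S k × (∀ j → j < k → ¬ ColorableOn G S j)

AllVertices : (G : Graph) → Vertex G → Set
AllVertices G _ = Data.Unit.⊤
  where import Data.Unit

Minus : (G : Graph) → Vertex G → Vertex G → Set
Minus G v x = x ≢ v

ChromaticNumber : Graph → ℕ → Set
ChromaticNumber G k = ChromaticNumberOn G (AllVertices G) k

Critical : Graph → Set
Critical G = ∀ k → ChromaticNumber G k →
  ∀ v → Σ ℕ λ k' → ChromaticNumberOn G (Minus G v) k' × k' < k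

-- The Chair (fork): vertices c=0,a=1,b=2,d=3,e=4, edges ca,cb,cd,de.

chairAdj : Fin 5 → Fin 5 → Bool
chairAdj Fin.zero (Fin.suc Fin.zero) = true
chairAdj Fin.zero (Fin.suc (Fin.suc Fin.zero)) = true
chairAdj Fin.zero (Fin.suc (Fin.suc (Fin.suc Fin.zero))) = true
chairAdj (Fin.suc Fin.zero) Fin.zero = true
chairAdj (Fin.suc (Fin.suc Fin.zero)) Fin.zero = true
chairAdj (Fin.suc (Fin.suc (Fin.suc Fin.zero))) Fin.zero = true
chairAdj (Fin.suc (Fin.suc (Fin.suc Fin.zero))) (Fin.suc (Fin.suc (Fin.suc (Fin.suc Fin.zero)))) = true
chairAdj (Fin.suc (Fin.suc (Fin.suc (Fin.suc Fin.zero)))) (Fin.suc (Fin.suc (Fin.suc Fin.zero))) = true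
chairAdj _ _ = false

InducedChair : (G : Graph) → Set
InducedChair G = Σ (Fin 5 → Vertex G) λ f →
  (∀ i j → f i ≡ f j → i ≡ j) ×
  (∀ i j → i ≢ j → adj G (f i) (f j) ≡ chairAdj i j)

ChairFree : Graph → Set
ChairFree G = ¬ InducedChair G

count : {m : ℕ} → (Fin m → Bool) → ℕ
count {m} p = go (allFin m)
  where
  go : List (Fin m) → ℕ
  go [] = 0
  go (x ∷ xs) = if p x then suc (go xs) else go xs

anyV : {m : ℕ} → (Fin m → Bool) → Bool
anyV {m} p = go (allFin m)
  where
  go : List (Fin m) → Bool
  go [] = false
  go (x ∷ xs) = if p x then true else go xs

isR : (G : Graph) → Vertex G → (Vertex G → ℕ) → Vertex G → Bool
isR G u C x = adj G u x ∧
  not (anyV (λ y → not (does (y ≟ x)) ∧ adj G u y ∧ (C y ≡ᵇ C x)))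

sizeR : (G : Graph) → Vertex G → (Vertex G → ℕ) → ℕ
sizeR G u C = count (isR G u C)

numColored : (G : Graph) → Vertex G → (Vertex G → ℕ) → ℕ → ℕ
numColored G u C c = count (λ y → adj G u y ∧ (C y ≡ᵇ c))

Repeated : (G : Graph) → Vertex G → (Vertex G → ℕ) → ℕ → Set
Repeated G u C c = Σ (Vertex G) λ x → Σ (Vertex G) λ y →
  x ≢ y × Adj G u x × Adj G u y × C x ≡ c × C y ≡ c

IsTriple : (G : Graph) → ℕ → Vertex G → (Vertex G → ℕ) → List ℕ → Set
IsTriple G k u C α =
  ProperColoringOn G (Minus G u) k C ×
  Unique α ×
  (∀ c → (c ∈ α) ⇔ Repeated G u C c)

Ns : (G : Graph) → Vertex G → (Vertex G → ℕ) → List ℕ → List ℕ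
Ns G u C α = map (numColored G u C) α

data Lex< : List ℕ → List ℕ → Set where
  nil<  : ∀ {y ys} → Lex< [] (y ∷ ys)
  here< : ∀ {x y xs ys} → x < y → Lex< (x ∷ xs) (y ∷ ys)
  next< : ∀ {x xs ys} → Lex< xs ys → Lex< (x ∷ xs) (x ∷ ys)

Better : (G : Graph) →
  Vertex G → (Vertex G → ℕ) → List ℕ →
  Vertex G → (Vertex G → ℕ) → List ℕ → Set
Better G u' C' α' u C α =
  (sizeR G u C < sizeR G u' C') ⊎
  ((sizeR G u' C' ≡ sizeR G u C) × Lex< (Ns G u' C' α') (Ns G u C α))

Optimal : (G : Graph) → ℕ → Vertex G → (Vertex G → ℕ) → List ℕ → Set
Optimal G k u C α =
  IsTriple G k u C α ×
  (∀ u' C' α' → IsTriple G k u' C' α' → ¬ Better G u' C' α' u C α)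

{-# OPTIONS --safe #-}
-- Let k = χ − 1. Every colour below k occurs in N(u), for otherwise C would extend to a
-- k-colouring of G. So each colour below k is either carried by a single vertex of N(u), which
-- then lies in R, or is repeated and listed in α; counting colours gives |R| + m = k.
-- For (A) and (B), let x ∈ N(u) have no neighbour in N(u) of some repeated colour γ. Then x has
-- no γ-coloured neighbour at all, since such a neighbour, u, x and two γ-coloured vertices of
-- N(u) would induce a Chair; hence x can be recoloured γ. For x ∈ R this frees the colour of x
-- at u, contradicting χ(G) = χ. For x coloured αᵢ and γ = αⱼ with j > i, the new colouring
-- either turns αᵢ into a singleton colour, enlarging R, or keeps the repeated colours and
-- N₁, …, Nᵢ₋₁ while lowering Nᵢ; either way the triple was not optimal.

module Submission where

open import Defs hiding (sym)
open import Data.Nat using (ℕ; zero; suc; _<_; _≤_; _+_; _∸_; _≡ᵇ_; _≤?_; z≤n; s≤s)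
import Data.Nat.Properties as ℕ
open import Data.Nat.Properties using (≤-refl; ≤-pred; ≤-trans; +-mono-≤; +-mono-<-≤; +-mono-≤-<; m<n⇒m<1+n; m≤n⇒m<n∨m≡n; <⇒≢; +-suc; ≡ᵇ⇒≡; suc-injective; +-commutativeSemigroup)
open import Algebra.Properties.CommutativeSemigroup +-commutativeSemigroup using (interchange)
open import Data.Fin using (Fin; zero; suc)
import Data.Fin as Fin
import Data.Fin.Properties as FP
open import Data.Fin.Properties using (_≟_)
open import Data.Bool using (Bool; true; false; _∧_; not; T; if_then_else_)
import Data.Bool.Properties as Bool
open import Data.Bool.Properties using (¬-not; not-involutive; ∧-identityʳ; ∧-zeroʳ)
open import Data.Unit using (tt)
open import Data.List using (List; []; _∷_; length; lookup; map; filter; upTo; allFin)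
open import Data.List.Relation.Unary.Any using (here; there)
import Data.List.Relation.Unary.All as All
open import Data.List.Relation.Unary.AllPairs using (_∷_)
open import Data.List.Relation.Unary.Unique.Propositional using (Unique)
open import Data.List.Relation.Unary.Unique.Propositional.Properties using (allFin⁺; filter⁺; upTo⁺)
open import Data.List.Membership.Propositional using (_∈_; _∉_)
open import Data.List.Membership.Propositional.Properties using (∈-allFin; ∈-filter⁺; ∈-filter⁻; ∈-upTo⁺; ∈-lookup)
open import Data.Product using (Σ; _×_; _,_; proj₁; proj₂)
open import Data.Sum using (_⊎_; inj₁; inj₂)
open import Relation.Nullary using (¬_; Dec; yes; no; does; contradiction)
open import Relation.Nullary.Decidable using (dec-true; dec-false; does-⇔; _×-dec_)
open import Relation.Binary.PropositionalEquality using (_≡_; _≢_; refl; sym; trans; cong; cong₂; subst; ≢-sym; module ≡-Reasoning)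
open import Function using (_∘_)
open import Function.Bundles using (_⇔_; mk⇔; Equivalence)

false≢true : false ≢ true
false≢true ()

≡ᵇ-true⇒≡ : ∀ m n → (m ≡ᵇ n) ≡ true → m ≡ n
≡ᵇ-true⇒≡ m n e = ≡ᵇ⇒≡ m n (subst T (sym e) tt)

≡ᵇ1≡not[2≤?] : ∀ n → 1 ≤ n → (n ≡ᵇ 1) ≡ not (does (2 ≤? n))
≡ᵇ1≡not[2≤?] (suc zero)    _ = refl
≡ᵇ1≡not[2≤?] (suc (suc n)) _ = refl

-- Finite sums over colours

[_] : Bool → ℕ
[ true ]  = 1
[ false ] = 0

sumBelow : ℕ → (ℕ → ℕ) → ℕ
sumBelow zero    f = 0
sumBelow (suc k) f = f k + sumBelow k f

sumBelow-cong : ∀ k {f g : ℕ → ℕ} → (∀ c → c < k → f c ≡ g c) → sumBelow k f ≡ sumBelow k g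
sumBelow-cong zero    f≗g = refl
sumBelow-cong (suc k) f≗g = cong₂ _+_ (f≗g k ≤-refl) (sumBelow-cong k (λ c c<k → f≗g c (m<n⇒m<1+n c<k)))

sumBelow-mono-≤ : ∀ k {f g : ℕ → ℕ} → (∀ c → c < k → f c ≤ g c) → sumBelow k f ≤ sumBelow k g
sumBelow-mono-≤ zero    f≤g = z≤n
sumBelow-mono-≤ (suc k) f≤g = +-mono-≤ (f≤g k ≤-refl) (sumBelow-mono-≤ k (λ c c<k → f≤g c (m<n⇒m<1+n c<k)))

sumBelow-mono-< : ∀ k {f g : ℕ → ℕ} {a} → (∀ c → c < k → f c ≤ g c) → a < k → f a < g a →
                  sumBelow k f < sumBelow k g
sumBelow-mono-< (suc k) {a = a} f≤g a<1+k fa<ga with m≤n⇒m<n∨m≡n (≤-pred a<1+k)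
... | inj₁ a<k  = +-mono-≤-< (f≤g k ≤-refl) (sumBelow-mono-< k (λ c c<k → f≤g c (m<n⇒m<1+n c<k)) a<k fa<ga)
... | inj₂ refl = +-mono-<-≤ fa<ga (sumBelow-mono-≤ a (λ c c<a → f≤g c (m<n⇒m<1+n c<a)))

sumBelow-+ : ∀ k (f g : ℕ → ℕ) → sumBelow k (λ c → f c + g c) ≡ sumBelow k f + sumBelow k g
sumBelow-+ zero    f g = refl
sumBelow-+ (suc k) f g rewrite sumBelow-+ k f g = interchange (f k) (g k) (sumBelow k f) (sumBelow k g)

sumBelow-zero : ∀ k → sumBelow k (λ _ → 0) ≡ 0
sumBelow-zero zero    = refl
sumBelow-zero (suc k) = sumBelow-zero k

sumBelow-one : ∀ k → sumBelow k (λ _ → 1) ≡ k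
sumBelow-one zero    = refl
sumBelow-one (suc k) = cong suc (sumBelow-one k)

sumBelow-indicator : ∀ k {a} → a < k → sumBelow k (λ c → [ a ≡ᵇ c ]) ≡ 1
sumBelow-indicator (suc k) {a} a<1+k with m≤n⇒m<n∨m≡n (≤-pred a<1+k)
... | inj₁ a<k  rewrite dec-false (a ℕ.≟ k) (<⇒≢ a<k) = sumBelow-indicator k a<k
... | inj₂ refl rewrite dec-true (a ℕ.≟ a) refl =
  cong suc (trans (sumBelow-cong a (λ c c<a → cong [_] (dec-false (a ℕ.≟ c) (≢-sym (<⇒≢ c<a))))) (sumBelow-zero a))

[not-does]-mono : ∀ {A B : Set} (a? : Dec A) (b? : Dec B) → (B → A) → [ not (does a?) ] ≤ [ not (does b?) ]
[not-does]-mono (yes _) _       _   = z≤n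
[not-does]-mono (no ¬a) (yes b) b⇒a = contradiction (b⇒a b) ¬a
[not-does]-mono (no _)  (no _)  _   = ≤-refl

-- Counting vertices

-- Shaped like the predicate inside `isR`, so that `isR` unfolds to it definitionally.
without : {m : ℕ} → Fin m → (Fin m → Bool) → Fin m → Bool
without x p y = not (does (y ≟ x)) ∧ p y

without-elim : {m : ℕ} {x y : Fin m} {p : Fin m → Bool} → without x p y ≡ true → y ≢ x × p y ≡ true
without-elim {x = x} {y} h with y ≟ x
... | no y≢x = y≢x , h
... | yes _  with () ← h

-- The list recursions inside `count` and `anyV` are local to Defs; these metavariables are
-- solved to them by the accompanying equations, which lets us reason by induction on lists.
mutual
  countIn : {m : ℕ} → (Fin m → Bool) → List (Fin m) → ℕ
  countIn p = _

  count≡countIn : {m : ℕ} (p : Fin m → Bool) → count p ≡ countIn p (allFin m)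
  count≡countIn {m} p with allFin m
  ... | xs = refl

mutual
  anyIn : {m : ℕ} → (Fin m → Bool) → List (Fin m) → Bool
  anyIn p = _

  anyV≡anyIn : {m : ℕ} (p : Fin m → Bool) → anyV p ≡ anyIn p (allFin m)
  anyV≡anyIn {m} p with allFin m
  ... | xs = refl

module _ {m : ℕ} where

  countIn-∷ : (p : Fin m → Bool) (x : Fin m) (xs : List (Fin m)) → countIn p (x ∷ xs) ≡ [ p x ] + countIn p xs
  countIn-∷ p x xs with p x
  ... | true  = refl
  ... | false = refl

  countIn-cong : {p q : Fin m → Bool} (xs : List (Fin m)) → (∀ z → z ∈ xs → p z ≡ q z) → countIn p xs ≡ countIn q xs
  countIn-cong []       p≗q = refl
  countIn-cong {p} {q} (x ∷ xs) p≗q = begin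
    countIn p (x ∷ xs)     ≡⟨ countIn-∷ p x xs ⟩
    [ p x ] + countIn p xs ≡⟨ cong₂ _+_ (cong [_] (p≗q x (here refl)))
                                       (countIn-cong xs (λ z z∈xs → p≗q z (there z∈xs))) ⟩
    [ q x ] + countIn q xs ≡⟨ sym (countIn-∷ q x xs) ⟩
    countIn q (x ∷ xs)     ∎
    where open ≡-Reasoning

  countIn-differAt : {p q : Fin m → Bool} {y : Fin m} (xs : List (Fin m)) → Unique xs → y ∈ xs →
                     p y ≡ true → q y ≡ false → (∀ z → z ≢ y → p z ≡ q z) →
                     countIn p xs ≡ suc (countIn q xs)
  countIn-differAt {p} {q} (y ∷ xs) (y∉xs ∷ _) (here refl) py qy p≗q = begin
    countIn p (y ∷ xs)           ≡⟨ countIn-∷ p y xs ⟩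
    [ p y ] + countIn p xs       ≡⟨ cong₂ _+_ (cong [_] py)
                                             (countIn-cong xs (λ z z∈xs → p≗q z (≢-sym (All.lookup y∉xs z∈xs)))) ⟩
    suc (countIn q xs)           ≡⟨ cong (λ b → suc ([ b ] + countIn q xs)) (sym qy) ⟩
    suc ([ q y ] + countIn q xs) ≡⟨ cong suc (sym (countIn-∷ q y xs)) ⟩
    suc (countIn q (y ∷ xs))     ∎
    where open ≡-Reasoning
  countIn-differAt {p} {q} (x ∷ xs) (x∉xs ∷ unique) (there y∈xs) py qy p≗q = begin
    countIn p (x ∷ xs)           ≡⟨ countIn-∷ p x xs ⟩
    [ p x ] + countIn p xs       ≡⟨ cong₂ _+_ (cong [_] (p≗q x (All.lookup x∉xs y∈xs)))
                                             (countIn-differAt xs unique y∈xs py qy p≗q) ⟩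
    [ q x ] + suc (countIn q xs) ≡⟨ +-suc [ q x ] (countIn q xs) ⟩
    suc ([ q x ] + countIn q xs) ≡⟨ cong suc (sym (countIn-∷ q x xs)) ⟩
    suc (countIn q (x ∷ xs))     ∎
    where open ≡-Reasoning

  countIn≡0 : (p : Fin m → Bool) (xs : List (Fin m)) → countIn p xs ≡ 0 → ∀ {z} → z ∈ xs → p z ≡ false
  countIn≡0 p (x ∷ xs) none z∈ with p x in px
  countIn≡0 p (x ∷ xs) none (here refl)  | false = px
  countIn≡0 p (x ∷ xs) none (there z∈xs) | false = countIn≡0 p xs none z∈xs

  countIn-witness : (p : Fin m → Bool) (xs : List (Fin m)) → 0 < countIn p xs → Σ (Fin m) λ z → p z ≡ true
  countIn-witness p (x ∷ xs) pos with p x in px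
  ... | true  = x , px
  ... | false = countIn-witness p xs pos

  anyIn≡ : (p : Fin m → Bool) (xs : List (Fin m)) → anyIn p xs ≡ not (countIn p xs ≡ᵇ 0)
  anyIn≡ p []       = refl
  anyIn≡ p (x ∷ xs) with p x
  ... | true  = refl
  ... | false = anyIn≡ p xs

  countIn-byValue : ∀ k (p : Fin m → Bool) (f : Fin m → ℕ) → (∀ z → p z ≡ true → f z < k) → (xs : List (Fin m)) →
                    countIn p xs ≡ sumBelow k (λ c → countIn (λ z → p z ∧ (f z ≡ᵇ c)) xs)
  countIn-byValue k p f bounded []       = sym (sumBelow-zero k)
  countIn-byValue k p f bounded (x ∷ xs) = begin
    countIn p (x ∷ xs)
      ≡⟨ countIn-∷ p x xs ⟩
    [ p x ] + countIn p xs
      ≡⟨ cong₂ _+_ (head (p x) refl) (countIn-byValue k p f bounded xs) ⟩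
    sumBelow k (λ c → [ p x ∧ (f x ≡ᵇ c) ]) + sumBelow k (λ c → countIn (p∧f≡ c) xs)
      ≡⟨ sym (sumBelow-+ k _ _) ⟩
    sumBelow k (λ c → [ p x ∧ (f x ≡ᵇ c) ] + countIn (p∧f≡ c) xs)
      ≡⟨ sumBelow-cong k (λ c _ → sym (countIn-∷ (p∧f≡ c) x xs)) ⟩
    sumBelow k (λ c → countIn (p∧f≡ c) (x ∷ xs)) ∎
    where
    open ≡-Reasoning
    p∧f≡ : ℕ → Fin m → Bool
    p∧f≡ c z = p z ∧ (f z ≡ᵇ c)
    head : (b : Bool) → p x ≡ b → [ b ] ≡ sumBelow k (λ c → [ b ∧ (f x ≡ᵇ c) ])
    head true  px = sym (sumBelow-indicator k (bounded x px))
    head false _  = sym (sumBelow-zero k)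

  countIn-false : (xs : List (Fin m)) → countIn (λ _ → false) xs ≡ 0
  countIn-false []       = refl
  countIn-false (x ∷ xs) = countIn-false xs

module _ {m : ℕ} where

  count-cong : {p q : Fin m → Bool} → (∀ z → p z ≡ q z) → count p ≡ count q
  count-cong p≗q = countIn-cong (allFin m) (λ z _ → p≗q z)

  count-differAt : {p q : Fin m → Bool} (y : Fin m) → p y ≡ true → q y ≡ false → (∀ z → z ≢ y → p z ≡ q z) →
                   count p ≡ suc (count q)
  count-differAt y = countIn-differAt (allFin m) (allFin⁺ m) (∈-allFin y)

  count-without : (p : Fin m → Bool) (x : Fin m) → p x ≡ true → count p ≡ suc (count (without x p))
  count-without p x px = count-differAt x px (cong (λ b → not b ∧ p x) (dec-true (x ≟ x) refl))
                                             (λ z z≢x → cong (λ b → not b ∧ p z) (sym (dec-false (z ≟ x) z≢x)))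

  count≡0 : (p : Fin m → Bool) → count p ≡ 0 → ∀ z → p z ≡ false
  count≡0 p none z = countIn≡0 p (allFin m) none (∈-allFin z)

  count-witness : (p : Fin m → Bool) → 0 < count p → Σ (Fin m) λ z → p z ≡ true
  count-witness p = countIn-witness p (allFin m)

  anyV≡ : (p : Fin m → Bool) → anyV p ≡ not (count p ≡ᵇ 0)
  anyV≡ p = anyIn≡ p (allFin m)

  count-∧false : (p : Fin m → Bool) → count (λ z → p z ∧ false) ≡ 0
  count-∧false p = trans (count-cong (λ z → ∧-zeroʳ (p z))) (countIn-false (allFin m))

  count-byValue : ∀ k (p : Fin m → Bool) (f : Fin m → ℕ) → (∀ z → p z ≡ true → f z < k) →
                  count p ≡ sumBelow k (λ c → count (λ z → p z ∧ (f z ≡ᵇ c)))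
  count-byValue k p f bounded = countIn-byValue k p f bounded (allFin m)

-- Lists of colours

occurrences : ℕ → List ℕ → ℕ
occurrences c []       = 0
occurrences c (x ∷ xs) = [ x ≡ᵇ c ] + occurrences c xs

length≡sumBelow-occurrences : ∀ k (xs : List ℕ) → (∀ {x} → x ∈ xs → x < k) →
                              length xs ≡ sumBelow k (λ c → occurrences c xs)
length≡sumBelow-occurrences k []       _       = sym (sumBelow-zero k)
length≡sumBelow-occurrences k (x ∷ xs) bounded = begin
  suc (length xs)
    ≡⟨ cong₂ _+_ (sym (sumBelow-indicator k (bounded (here refl))))
                 (length≡sumBelow-occurrences k xs (λ x∈ → bounded (there x∈))) ⟩
  sumBelow k (λ c → [ x ≡ᵇ c ]) + sumBelow k (λ c → occurrences c xs)
    ≡⟨ sym (sumBelow-+ k _ _) ⟩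
  sumBelow k (λ c → occurrences c (x ∷ xs)) ∎
  where open ≡-Reasoning

occurrences-∉ : ∀ {c} xs → c ∉ xs → occurrences c xs ≡ 0
occurrences-∉         []       _    = refl
occurrences-∉ {c} (x ∷ xs) c∉ rewrite dec-false (x ℕ.≟ c) (λ x≡c → c∉ (here (sym x≡c))) =
  occurrences-∉ xs (λ c∈ → c∉ (there c∈))

occurrences-unique : ∀ {c} {xs} → Unique xs → c ∈ xs → occurrences c xs ≡ 1
occurrences-unique {c} {x ∷ xs} (x∉xs ∷ _) (here refl) rewrite dec-true (c ℕ.≟ c) refl =
  cong suc (occurrences-∉ xs (λ c∈ → All.lookup x∉xs c∈ refl))
occurrences-unique {c} {x ∷ xs} (x∉xs ∷ unique) (there c∈) rewrite dec-false (x ℕ.≟ c) (All.lookup x∉xs c∈) =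
  occurrences-unique unique c∈

lookup-injective : ∀ {xs : List ℕ} → Unique xs → ∀ {i j} → lookup xs i ≡ lookup xs j → i ≡ j
lookup-injective {_ ∷ _} _          {zero}  {zero}  _ = refl
lookup-injective {_ ∷ _} (x∉xs ∷ _) {zero}  {suc j} e = contradiction e (All.lookup x∉xs (∈-lookup j))
lookup-injective {_ ∷ _} (x∉xs ∷ _) {suc i} {zero}  e = contradiction (sym e) (All.lookup x∉xs (∈-lookup i))
lookup-injective {_ ∷ _} (_ ∷ unique) {suc i} {suc j} e = cong suc (lookup-injective unique e)

Lex<-map : ∀ (f g : ℕ → ℕ) (xs : List ℕ) (i : Fin (length xs)) →
           (∀ j → j Fin.< i → f (lookup xs j) ≡ g (lookup xs j)) → f (lookup xs i) < g (lookup xs i) →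
           Lex< (map f xs) (map g xs)
Lex<-map f g (x ∷ xs) zero    _     fx<gx = here< fx<gx
Lex<-map f g (x ∷ xs) (suc i) agree lt rewrite agree zero (s≤s z≤n) =
  next< (Lex<-map f g xs i (λ j j<i → agree (suc j) (s≤s j<i)) lt)

-- Colourings and the Chair

module Colouring (G : Graph) where

  adj-sym : ∀ {a b v} → adj G a b ≡ v → adj G b a ≡ v
  adj-sym {a} {b} ab = trans (Graph.sym G b a) ab

  Adj⇒≢ : ∀ {a b} → Adj G a b → a ≢ b
  Adj⇒≢ {a} ab refl = false≢true (trans (sym (irref G a)) ab)

  distinguishedBy : ∀ {a b w} → Adj G a w → adj G b w ≡ false → a ≢ b
  distinguishedBy aw bw refl = false≢true (trans (sym bw) aw)

  ¬Adj⇒false : ∀ {a b} → ¬ Adj G a b → adj G a b ≡ false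
  ¬Adj⇒false = ¬-not

  recolour : (Vertex G → ℕ) → Vertex G → ℕ → Vertex G → ℕ
  recolour C v c w = if does (w ≟ v) then c else C w

  recolour-at : ∀ C v c → recolour C v c v ≡ c
  recolour-at C v c rewrite dec-true (v ≟ v) refl = refl

  recolour-off : ∀ C {v} c {w} → w ≢ v → recolour C v c w ≡ C w
  recolour-off C {v} c {w} w≢v rewrite dec-false (w ≟ v) w≢v = refl

  properOn-mono : ∀ {S₁ S₂ k C} → (∀ w → S₂ w → S₁ w) → ProperColoringOn G S₁ k C → ProperColoringOn G S₂ k C
  properOn-mono S₂⊆S₁ (bounded , proper) =
    (λ x sx → bounded x (S₂⊆S₁ x sx)) , (λ x y sx sy → proper x y (S₂⊆S₁ x sx) (S₂⊆S₁ y sy))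

  properOn-recolour : ∀ {S k C v c} → ProperColoringOn G S k C → c < k →
                      (∀ w → S w → Adj G v w → C w ≢ c) →
                      ProperColoringOn G (λ w → S w ⊎ w ≡ v) k (recolour C v c)
  properOn-recolour {S} {k} {C} {v} {c} (bounded , proper) c<k free = bounded′ , proper′
    where
    inS : ∀ {w} → S w ⊎ w ≡ v → w ≢ v → S w
    inS (inj₁ sw)  _   = sw
    inS (inj₂ w≡v) w≢v = contradiction w≡v w≢v
    bounded′ : ∀ w → S w ⊎ w ≡ v → recolour C v c w < k
    bounded′ w sw with w ≟ v
    ... | yes _   = c<k
    ... | no w≢v  = bounded w (inS sw w≢v)
    proper′ : ∀ x y → S x ⊎ x ≡ v → S y ⊎ y ≡ v → Adj G x y → recolour C v c x ≢ recolour C v c y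
    proper′ x y sx sy xy with x ≟ v | y ≟ v
    ... | yes refl | yes refl = contradiction refl (Adj⇒≢ xy)
    ... | yes refl | no y≢v   = ≢-sym (free y (inS sy y≢v) xy)
    ... | no x≢v   | yes refl = free x (inS sx x≢v) (adj-sym xy)
    ... | no x≢v   | no y≢v   = proper x y (inS sx x≢v) (inS sy y≢v) xy

  absentColour⇒colourable : ∀ {u k D c} → ProperColoringOn G (Minus G u) k D → c < k →
                            (∀ w → Adj G u w → D w ≢ c) → ColorableOn G (AllVertices G) k
  absentColour⇒colourable {u} {k} {D} {c} proper c<k absent =
    recolour D u c , properOn-mono everyVertex (properOn-recolour proper c<k (λ w _ → absent w))
    where
    everyVertex : ∀ w → AllVertices G w → Minus G u w ⊎ w ≡ u
    everyVertex w _ with w ≟ u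
    ... | yes w≡u = inj₂ w≡u
    ... | no  w≢u = inj₁ w≢u

  -- The vertices c, a, b, d, e of the Chair, in the order used by `chairAdj`.
  pattern centre = zero
  pattern leaf₁  = suc zero
  pattern leaf₂  = suc (suc zero)
  pattern stem   = suc (suc (suc zero))
  pattern tip    = suc (suc (suc (suc zero)))

  inducedChair : ∀ {u z₁ z₂ x p} → Adj G u z₁ → Adj G u z₂ → Adj G u x → Adj G x p → z₁ ≢ z₂ →
                 adj G z₁ z₂ ≡ false → adj G z₁ x ≡ false → adj G z₂ x ≡ false →
                 adj G u p ≡ false → adj G z₁ p ≡ false → adj G z₂ p ≡ false → InducedChair G
  inducedChair {u} {z₁} {z₂} {x} {p} uz₁ uz₂ ux xp z₁≢z₂ z₁z₂ z₁x z₂x up z₁p z₂p = f , injective , adjacent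
    where
    f : Fin 5 → Vertex G
    f centre = u
    f leaf₁  = z₁
    f leaf₂  = z₂
    f stem   = x
    f tip    = p
    u≢z₁ : u ≢ z₁
    u≢z₁ = Adj⇒≢ uz₁
    u≢z₂ : u ≢ z₂
    u≢z₂ = Adj⇒≢ uz₂
    u≢x : u ≢ x
    u≢x = Adj⇒≢ ux
    u≢p : u ≢ p
    u≢p = distinguishedBy uz₁ (adj-sym z₁p)
    x≢z₁ : x ≢ z₁
    x≢z₁ = distinguishedBy xp z₁p
    x≢z₂ : x ≢ z₂
    x≢z₂ = distinguishedBy xp z₂p
    z₁≢p : z₁ ≢ p
    z₁≢p = distinguishedBy (adj-sym uz₁) (adj-sym up)
    z₂≢p : z₂ ≢ p
    z₂≢p = distinguishedBy (adj-sym uz₂) (adj-sym up)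
    x≢p : x ≢ p
    x≢p = Adj⇒≢ xp
    injective : ∀ i j → f i ≡ f j → i ≡ j
    injective centre centre _ = refl
    injective centre leaf₁  e = contradiction e u≢z₁
    injective centre leaf₂  e = contradiction e u≢z₂
    injective centre stem   e = contradiction e u≢x
    injective centre tip    e = contradiction e u≢p
    injective leaf₁  centre e = contradiction (sym e) u≢z₁
    injective leaf₁  leaf₁  _ = refl
    injective leaf₁  leaf₂  e = contradiction e z₁≢z₂
    injective leaf₁  stem   e = contradiction (sym e) x≢z₁
    injective leaf₁  tip    e = contradiction e z₁≢p
    injective leaf₂  centre e = contradiction (sym e) u≢z₂
    injective leaf₂  leaf₁  e = contradiction (sym e) z₁≢z₂
    injective leaf₂  leaf₂  _ = refl
    injective leaf₂  stem   e = contradiction (sym e) x≢z₂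
    injective leaf₂  tip    e = contradiction e z₂≢p
    injective stem   centre e = contradiction (sym e) u≢x
    injective stem   leaf₁  e = contradiction e x≢z₁
    injective stem   leaf₂  e = contradiction e x≢z₂
    injective stem   stem   _ = refl
    injective stem   tip    e = contradiction e x≢p
    injective tip    centre e = contradiction (sym e) u≢p
    injective tip    leaf₁  e = contradiction (sym e) z₁≢p
    injective tip    leaf₂  e = contradiction (sym e) z₂≢p
    injective tip    stem   e = contradiction (sym e) x≢p
    injective tip    tip    _ = refl
    adjacent : ∀ i j → i ≢ j → adj G (f i) (f j) ≡ chairAdj i j
    adjacent centre centre i≢i = contradiction refl i≢i
    adjacent centre leaf₁  _   = uz₁
    adjacent centre leaf₂  _   = uz₂
    adjacent centre stem   _   = ux
    adjacent centre tip    _   = up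
    adjacent leaf₁  centre _   = adj-sym uz₁
    adjacent leaf₁  leaf₁  i≢i = contradiction refl i≢i
    adjacent leaf₁  leaf₂  _   = z₁z₂
    adjacent leaf₁  stem   _   = z₁x
    adjacent leaf₁  tip    _   = z₁p
    adjacent leaf₂  centre _   = adj-sym uz₂
    adjacent leaf₂  leaf₁  _   = adj-sym z₁z₂
    adjacent leaf₂  leaf₂  i≢i = contradiction refl i≢i
    adjacent leaf₂  stem   _   = z₂x
    adjacent leaf₂  tip    _   = z₂p
    adjacent stem   centre _   = adj-sym ux
    adjacent stem   leaf₁  _   = adj-sym z₁x
    adjacent stem   leaf₂  _   = adj-sym z₂x
    adjacent stem   stem   i≢i = contradiction refl i≢i
    adjacent stem   tip    _   = xp
    adjacent tip    centre _   = adj-sym up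
    adjacent tip    leaf₁  _   = adj-sym z₁p
    adjacent tip    leaf₂  _   = adj-sym z₂p
    adjacent tip    stem   _   = adj-sym xp
    adjacent tip    tip    i≢i = contradiction refl i≢i

-- Colour multiplicities in N(u)

module Neighbourhood (G : Graph) (u : Vertex G) (C : Vertex G → ℕ) where

  open Colouring G

  colouredIn : ℕ → Vertex G → Bool
  colouredIn c w = adj G u w ∧ (C w ≡ᵇ c)

  multiplicity : ℕ → ℕ
  multiplicity = numColored G u C

  colouredIn-intro : ∀ {c w} → Adj G u w → C w ≡ c → colouredIn c w ≡ true
  colouredIn-intro {c} {w} uw Cw≡c rewrite uw = dec-true (C w ℕ.≟ c) Cw≡c

  colouredIn-elim : ∀ {c w} → colouredIn c w ≡ true → Adj G u w × C w ≡ c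
  colouredIn-elim {c} {w} h with adj G u w
  ... | true = refl , ≡ᵇ-true⇒≡ (C w) c h

  isR≡ : ∀ x → isR G u C x ≡ adj G u x ∧ (multiplicity (C x) ≡ᵇ 1)
  isR≡ x with adj G u x in ux
  ... | false = refl
  ... | true  = begin
    not (anyV others)               ≡⟨ cong not (anyV≡ others) ⟩
    not (not (count others ≡ᵇ 0))   ≡⟨ not-involutive _ ⟩
    count others ≡ᵇ 0               ≡⟨ cong (_≡ᵇ 1) (sym (count-without (colouredIn (C x)) x (colouredIn-intro ux refl))) ⟩
    multiplicity (C x) ≡ᵇ 1         ∎
    where
    open ≡-Reasoning
    others : Vertex G → Bool
    others = without x (colouredIn (C x))

  isR⇒adj : ∀ {x} → isR G u C x ≡ true → Adj G u x
  isR⇒adj {x} x∈R with adj G u x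
  ... | true = refl
  ... | false = x∈R

  isR⇒singleton : ∀ {x} → isR G u C x ≡ true → multiplicity (C x) ≡ 1
  isR⇒singleton {x} x∈R with adj G u x | isR≡ x
  ... | true | eq = ≡ᵇ-true⇒≡ (multiplicity (C x)) 1 (trans (sym eq) x∈R)
  ... | false | eq with () ← trans (sym eq) x∈R

  isR⇒colourUnique : ∀ {x w} → isR G u C x ≡ true → Adj G u w → w ≢ x → C w ≢ C x
  isR⇒colourUnique {x} {w} x∈R uw w≢x Cw≡Cx = false≢true (trans (sym (count≡0 others noOthers w)) othersW)
    where
    others : Vertex G → Bool
    others = without x (colouredIn (C x))
    noOthers : count others ≡ 0
    noOthers = suc-injective (trans (sym (count-without (colouredIn (C x)) x (colouredIn-intro (isR⇒adj x∈R) refl)))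
                                    (isR⇒singleton x∈R))
    othersW : others w ≡ true
    othersW rewrite dec-false (w ≟ x) w≢x = colouredIn-intro uw Cw≡Cx

  Repeated⇒2≤multiplicity : ∀ {c} → Repeated G u C c → 2 ≤ multiplicity c
  Repeated⇒2≤multiplicity {c} (x , y , x≢y , ux , uy , Cx≡c , Cy≡c)
    rewrite count-without (colouredIn c) x (colouredIn-intro ux Cx≡c) =
    s≤s (subst (1 ≤_) (sym (count-without _ y yOther)) (s≤s z≤n))
    where
    yOther : without x (colouredIn c) y ≡ true
    yOther rewrite dec-false (y ≟ x) (≢-sym x≢y) = colouredIn-intro uy Cy≡c

  2≤multiplicity⇒Repeated : ∀ {c} → 2 ≤ multiplicity c → Repeated G u C c
  2≤multiplicity⇒Repeated {c} two with count-witness (colouredIn c) (≤-trans (s≤s z≤n) two)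
  ... | x , xc with count-witness (without x (colouredIn c)) (≤-pred (subst (2 ≤_) (count-without (colouredIn c) x xc) two))
  ... | y , yc with without-elim {p = colouredIn c} yc
  ... | y≢x , yc′ with colouredIn-elim xc | colouredIn-elim yc′
  ... | ux , Cx≡c | uy , Cy≡c = x , y , ≢-sym y≢x , ux , uy , Cx≡c , Cy≡c

  isR⇒notRepeated : ∀ {x} → isR G u C x ≡ true → ¬ Repeated G u C (C x)
  isR⇒notRepeated x∈R rep with subst (2 ≤_) (isR⇒singleton x∈R) (Repeated⇒2≤multiplicity rep)
  ... | s≤s ()

  sizeR≡#singletons : ∀ k → (∀ z → Adj G u z → C z < k) → sizeR G u C ≡ sumBelow k (λ c → [ multiplicity c ≡ᵇ 1 ])
  sizeR≡#singletons k bounded = begin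
    count (isR G u C)
      ≡⟨ count-byValue k (isR G u C) C (λ z z∈R → bounded z (isR⇒adj z∈R)) ⟩
    sumBelow k (λ c → count (λ z → isR G u C z ∧ (C z ≡ᵇ c)))
      ≡⟨ sumBelow-cong k (λ c _ → count-cong (byColour c)) ⟩
    sumBelow k (λ c → count (λ z → colouredIn c z ∧ (multiplicity c ≡ᵇ 1)))
      ≡⟨ sumBelow-cong k (λ c _ → singletons c) ⟩
    sumBelow k (λ c → [ multiplicity c ≡ᵇ 1 ]) ∎
    where
    open ≡-Reasoning
    byColour : ∀ c z → (isR G u C z ∧ (C z ≡ᵇ c)) ≡ (colouredIn c z ∧ (multiplicity c ≡ᵇ 1))
    byColour c z rewrite isR≡ z with C z ≡ᵇ c in Cz≡ᵇc | adj G u z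
    ... | true  | true  = trans (∧-identityʳ _) (cong (λ d → multiplicity d ≡ᵇ 1) (≡ᵇ-true⇒≡ (C z) c Cz≡ᵇc))
    ... | true  | false = refl
    ... | false | true  = ∧-zeroʳ _
    ... | false | false = refl
    singletons : ∀ c → count (λ z → colouredIn c z ∧ (multiplicity c ≡ᵇ 1)) ≡ [ multiplicity c ≡ᵇ 1 ]
    singletons c with multiplicity c ≡ᵇ 1 in single
    ... | true  = trans (count-cong {p = λ z → colouredIn c z ∧ true} (λ z → ∧-identityʳ _))
                        (≡ᵇ-true⇒≡ (multiplicity c) 1 single)
    ... | false = count-∧false (colouredIn c)

module Recoloured (G : Graph) (u y : Vertex G) (C : Vertex G → ℕ) (γ : ℕ) (uy : Adj G u y) (γ≢Cy : γ ≢ C y) where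

  open Colouring G
  open Neighbourhood G u C
  module N′ = Neighbourhood G u (recolour C y γ)

  private
    at-y : ∀ c → N′.colouredIn c y ≡ (γ ≡ᵇ c)
    at-y c rewrite uy | recolour-at C y γ = refl

    old-at-y : ∀ c → colouredIn c y ≡ (C y ≡ᵇ c)
    old-at-y c rewrite uy = refl

    off-y : ∀ c z → z ≢ y → N′.colouredIn c z ≡ colouredIn c z
    off-y c z z≢y rewrite recolour-off C γ z≢y = refl

  multiplicity-old : multiplicity (C y) ≡ suc (N′.multiplicity (C y))
  multiplicity-old = count-differAt y (colouredIn-intro uy refl) (trans (at-y (C y)) (dec-false (γ ℕ.≟ C y) γ≢Cy))
                       (λ z z≢y → sym (off-y (C y) z z≢y))

  multiplicity-new : N′.multiplicity γ ≡ suc (multiplicity γ)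
  multiplicity-new = count-differAt y (trans (at-y γ) (dec-true (γ ℕ.≟ γ) refl))
                       (trans (old-at-y γ) (dec-false (C y ℕ.≟ γ) (≢-sym γ≢Cy))) (off-y γ)

  multiplicity-other : ∀ {c} → c ≢ C y → c ≢ γ → N′.multiplicity c ≡ multiplicity c
  multiplicity-other {c} c≢Cy c≢γ = count-cong same
    where
    same : ∀ z → N′.colouredIn c z ≡ colouredIn c z
    same z with z ≟ y
    ... | no _     = refl
    ... | yes refl rewrite uy = trans (dec-false (γ ℕ.≟ c) (≢-sym c≢γ)) (sym (dec-false (C y ℕ.≟ c) (≢-sym c≢Cy)))

-- Colourings of G − u that do not extend to G

module NonExtendable (G : Graph) (u : Vertex G) (k : ℕ) (not-k-colourable : ¬ ColorableOn G (AllVertices G) k)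
                     (D : Vertex G → ℕ) (proper : ProperColoringOn G (Minus G u) k D) where

  open Colouring G
  open Neighbourhood G u D

  neighbour<k : ∀ {w} → Adj G u w → D w < k
  neighbour<k uw = proj₁ proper _ (≢-sym (Adj⇒≢ uw))

  Repeated⇒<k : ∀ {c} → Repeated G u D c → c < k
  Repeated⇒<k (x , _ , _ , ux , _ , Dx≡c , _) = subst (_< k) Dx≡c (neighbour<k ux)

  everyColourPresent : ∀ {c} → c < k → 1 ≤ multiplicity c
  everyColourPresent {c} c<k with multiplicity c in none
  ... | suc _ = s≤s z≤n
  ... | zero  = contradiction (absentColour⇒colourable proper c<k absent) not-k-colourable
    where
    absent : ∀ w → Adj G u w → D w ≢ c
    absent w uw Dw≡c = false≢true (trans (sym (count≡0 (colouredIn c) none w)) (colouredIn-intro uw Dw≡c))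

  sizeR≡#unrepeated : sizeR G u D ≡ sumBelow k (λ c → [ not (does (2 ≤? multiplicity c)) ])
  sizeR≡#unrepeated = trans (sizeR≡#singletons k (λ _ → neighbour<k))
    (sumBelow-cong k (λ c c<k → cong [_] (≡ᵇ1≡not[2≤?] (multiplicity c) (everyColourPresent c<k))))

  repeatedColours : List ℕ
  repeatedColours = filter (λ c → 2 ≤? multiplicity c) (upTo k)

  repeatedColours-triple : IsTriple G k u D repeatedColours
  repeatedColours-triple = proper , filter⁺ (λ c → 2 ≤? multiplicity c) {xs = upTo k} (upTo⁺ k) , λ c → mk⇔ to from
    where
    to : ∀ {c} → c ∈ repeatedColours → Repeated G u D c
    to c∈ = 2≤multiplicity⇒Repeated (proj₂ (∈-filter⁻ (λ c → 2 ≤? multiplicity c) {xs = upTo k} c∈))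
    from : ∀ {c} → Repeated G u D c → c ∈ repeatedColours
    from rep = ∈-filter⁺ (λ c → 2 ≤? multiplicity c) {xs = upTo k} (∈-upTo⁺ (Repeated⇒<k rep))
                         (Repeated⇒2≤multiplicity rep)

-- Optimal triples

module OptimalTriple (G : Graph) (χ : ℕ) (χ-chromatic : ChromaticNumber G χ)
                     (u : Vertex G) (C : Vertex G → ℕ) (α : List ℕ) (optimal : Optimal G (χ ∸ 1) u C α) where

  open Colouring G
  open Neighbourhood G u C

  k : ℕ
  k = χ ∸ 1

  proper : ProperColoringOn G (Minus G u) k C
  proper = proj₁ (proj₁ optimal)

  α-unique : Unique α
  α-unique = proj₁ (proj₂ (proj₁ optimal))

  α-repeated : ∀ {c} → c ∈ α ⇔ Repeated G u C c
  α-repeated = proj₂ (proj₂ (proj₁ optimal)) _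

  ∈α⇒2≤multiplicity : ∀ {c} → c ∈ α → 2 ≤ multiplicity c
  ∈α⇒2≤multiplicity = Repeated⇒2≤multiplicity ∘ Equivalence.to α-repeated

  2≤multiplicity⇒∈α : ∀ {c} → 2 ≤ multiplicity c → c ∈ α
  2≤multiplicity⇒∈α = Equivalence.from α-repeated ∘ 2≤multiplicity⇒Repeated

  lookup-distinct : ∀ {i j} → i Fin.< j → lookup α i ≢ lookup α j
  lookup-distinct i<j αi≡αj = FP.<-irrefl (lookup-injective α-unique αi≡αj) i<j

  not-k-colourable : ¬ ColorableOn G (AllVertices G) k
  not-k-colourable = proj₂ χ-chromatic k (ℕ.∸-monoʳ-< (s≤s z≤n) 0<χ)
    where
    0<χ : 0 < χ
    0<χ with (colour , bounded , _) ← proj₁ χ-chromatic = ℕ.≤-trans (s≤s z≤n) (bounded u _)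

  open NonExtendable G u k not-k-colourable C proper

  sizeR+length≡k : sizeR G u C + length α ≡ k
  sizeR+length≡k = begin
    sizeR G u C + length α
      ≡⟨ cong₂ _+_ sizeR≡#unrepeated (length≡sumBelow-occurrences k α (λ c∈ → Repeated⇒<k (Equivalence.to α-repeated c∈))) ⟩
    sumBelow k (λ c → [ not (does (2 ≤? multiplicity c)) ]) + sumBelow k (λ c → occurrences c α)
      ≡⟨ sym (sumBelow-+ k _ _) ⟩
    sumBelow k (λ c → [ not (does (2 ≤? multiplicity c)) ] + occurrences c α)
      ≡⟨ sumBelow-cong k (λ c _ → singletonOrInα c) ⟩
    sumBelow k (λ _ → 1)
      ≡⟨ sumBelow-one k ⟩
    k ∎
    where
    open ≡-Reasoning
    singletonOrInα : ∀ c → [ not (does (2 ≤? multiplicity c)) ] + occurrences c α ≡ 1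
    singletonOrInα c with 2 ≤? multiplicity c
    ... | yes two rewrite dec-true (2 ≤? multiplicity c) two = occurrences-unique {xs = α} α-unique (2≤multiplicity⇒∈α two)
    ... | no ¬two rewrite dec-false (2 ≤? multiplicity c) ¬two = cong suc (occurrences-∉ α (¬two ∘ ∈α⇒2≤multiplicity))

  length-α : length α ≡ χ ∸ (sizeR G u C + 1)
  length-α = begin
    length α                          ≡⟨ sym (ℕ.m+n∸m≡n |R| (length α)) ⟩
    |R| + length α ∸ |R|              ≡⟨ cong (_∸ |R|) sizeR+length≡k ⟩
    χ ∸ 1 ∸ |R|                       ≡⟨ ℕ.∸-+-assoc χ 1 |R| ⟩
    χ ∸ (1 + |R|)                     ≡⟨ cong (χ ∸_) (ℕ.+-comm 1 |R|) ⟩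
    χ ∸ (|R| + 1)                     ∎
    where
    open ≡-Reasoning
    |R| : ℕ
    |R| = sizeR G u C

  sameColour⇒nonadjacent : ∀ {a b} → a ≢ u → b ≢ u → C a ≡ C b → adj G a b ≡ false
  sameColour⇒nonadjacent a≢u b≢u Ca≡Cb = ¬Adj⇒false (λ ab → proj₂ proper _ _ a≢u b≢u ab Ca≡Cb)

  module Improvement {y : Vertex G} {i j : Fin (length α)} (uy : Adj G u y) (Cy≡αi : C y ≡ lookup α i) (i<j : i Fin.< j)
                     (proper′ : ProperColoringOn G (Minus G u) k (recolour C y (lookup α j))) where

    γi γj : ℕ
    γi = lookup α i
    γj = lookup α j

    γj≢Cy : γj ≢ C y
    γj≢Cy γj≡Cy = lookup-distinct i<j (trans (sym Cy≡αi) (sym γj≡Cy))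

    open Recoloured G u y C γj uy γj≢Cy
    module E′ = NonExtendable G u k not-k-colourable (recolour C y γj) proper′

    2≤γi : 2 ≤ multiplicity γi
    2≤γi = ∈α⇒2≤multiplicity (∈-lookup i)

    2≤γj : 2 ≤ multiplicity γj
    2≤γj = ∈α⇒2≤multiplicity (∈-lookup j)

    γi-drops : multiplicity γi ≡ suc (N′.multiplicity γi)
    γi-drops = subst (λ c → multiplicity c ≡ suc (N′.multiplicity c)) Cy≡αi multiplicity-old

    unchanged : ∀ {c} → c ≢ γi → c ≢ γj → N′.multiplicity c ≡ multiplicity c
    unchanged c≢γi = multiplicity-other (λ c≡Cy → c≢γi (trans c≡Cy Cy≡αi))

    repeated′⇒repeated : ∀ c → 2 ≤ N′.multiplicity c → 2 ≤ multiplicity c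
    repeated′⇒repeated c two′ with c ℕ.≟ γi | c ℕ.≟ γj
    ... | yes refl | _        = 2≤γi
    ... | no _     | yes refl = 2≤γj
    ... | no c≢γi  | no c≢γj  = subst (2 ≤_) (unchanged c≢γi c≢γj) two′

    repeated⇒repeated′ : ∀ c → c ≢ γi → 2 ≤ multiplicity c → 2 ≤ N′.multiplicity c
    repeated⇒repeated′ c c≢γi two with c ℕ.≟ γj
    ... | yes refl = subst (2 ≤_) (sym multiplicity-new) (ℕ.m≤n⇒m≤1+n two)
    ... | no c≢γj  = subst (2 ≤_) (sym (unchanged c≢γi c≢γj)) two

    better : Σ (List ℕ) λ α′ → IsTriple G k u (recolour C y γj) α′ × Better G u (recolour C y γj) α′ u C α
    better with 2 ≤? N′.multiplicity γi
    ... | no γi-singleton = E′.repeatedColours , E′.repeatedColours-triple , inj₁ moreSingletons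
      where
      moreSingletons : sizeR G u C < sizeR G u (recolour C y γj)
      moreSingletons rewrite sizeR≡#unrepeated | E′.sizeR≡#unrepeated =
        sumBelow-mono-< k (λ c _ → [not-does]-mono (2 ≤? multiplicity c) (2 ≤? N′.multiplicity c) (repeated′⇒repeated c))
          (Repeated⇒<k (Equivalence.to α-repeated (∈-lookup i))) strict
        where
        strict : [ not (does (2 ≤? multiplicity γi)) ] < [ not (does (2 ≤? N′.multiplicity γi)) ]
        strict rewrite dec-true (2 ≤? multiplicity γi) 2≤γi | dec-false (2 ≤? N′.multiplicity γi) γi-singleton = s≤s z≤n
    ... | yes γi-repeated = α , (proper′ , α-unique , λ c → mk⇔ (to c) (from c)) , inj₂ (sameSize , smallerAtγi)
      where
      repeated⇔ : ∀ c → 2 ≤ N′.multiplicity c ⇔ 2 ≤ multiplicity c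
      repeated⇔ c = mk⇔ (repeated′⇒repeated c) repeated⇒
        where
        repeated⇒ : 2 ≤ multiplicity c → 2 ≤ N′.multiplicity c
        repeated⇒ with c ℕ.≟ γi
        ... | yes refl = λ _ → γi-repeated
        ... | no c≢γi  = repeated⇒repeated′ c c≢γi
      to : ∀ c → c ∈ α → Repeated G u (recolour C y γj) c
      to c c∈ = N′.2≤multiplicity⇒Repeated (Equivalence.from (repeated⇔ c) (∈α⇒2≤multiplicity c∈))
      from : ∀ c → Repeated G u (recolour C y γj) c → c ∈ α
      from c rep′ = 2≤multiplicity⇒∈α (Equivalence.to (repeated⇔ c) (N′.Repeated⇒2≤multiplicity rep′))
      sameSize : sizeR G u (recolour C y γj) ≡ sizeR G u C
      sameSize = begin
        sizeR G u (recolour C y γj)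
          ≡⟨ E′.sizeR≡#unrepeated ⟩
        sumBelow k (λ c → [ not (does (2 ≤? N′.multiplicity c)) ])
          ≡⟨ sumBelow-cong k (λ c _ → cong (λ b → [ not b ])
                               (does-⇔ (repeated⇔ c) (2 ≤? N′.multiplicity c) (2 ≤? multiplicity c))) ⟩
        sumBelow k (λ c → [ not (does (2 ≤? multiplicity c)) ])
          ≡⟨ sym sizeR≡#unrepeated ⟩
        sizeR G u C ∎
        where open ≡-Reasoning
      smallerAtγi : Lex< (Ns G u (recolour C y γj) α) (Ns G u C α)
      smallerAtγi = Lex<-map N′.multiplicity multiplicity α i
        (λ l l<i → unchanged (lookup-distinct l<i) (lookup-distinct (FP.<-trans l<i i<j)))
        (subst (N′.multiplicity γi <_) (sym γi-drops) (ℕ.n<1+n _))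

  module _ (chair-free : ChairFree G) where

    recolouringFails⇒colouredNeighbour : ∀ {x γ} → Adj G u x → Repeated G u C γ →
                        ¬ ProperColoringOn G (Minus G u) k (recolour C x γ) →
                        Σ (Vertex G) λ z → Adj G u z × Adj G x z × C z ≡ γ
    recolouringFails⇒colouredNeighbour {x} {γ} ux rep@(z₁ , z₂ , z₁≢z₂ , uz₁ , uz₂ , Cz₁≡γ , Cz₂≡γ) recolouring-fails
      with FP.any? (λ z → (adj G u z Bool.≟ true) ×-dec (adj G x z Bool.≟ true) ×-dec (C z ℕ.≟ γ))
    ... | yes found = found
    ... | no none   = contradiction (properOn-mono (λ _ → inj₁) (properOn-recolour proper (Repeated⇒<k rep) noNeighbourColoured))
                                    recolouring-fails
      where
      z₁≢u : z₁ ≢ u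
      z₁≢u = ≢-sym (Adj⇒≢ uz₁)
      z₂≢u : z₂ ≢ u
      z₂≢u = ≢-sym (Adj⇒≢ uz₂)
      noNeighbourColoured : ∀ p → p ≢ u → Adj G x p → C p ≢ γ
      noNeighbourColoured p p≢u xp Cp≡γ = chair-free (inducedChair uz₁ uz₂ ux xp z₁≢z₂
        (sameColour⇒nonadjacent z₁≢u z₂≢u (trans Cz₁≡γ (sym Cz₂≡γ)))
        (adj-sym (¬Adj⇒false (λ xz₁ → none (z₁ , uz₁ , xz₁ , Cz₁≡γ))))
        (adj-sym (¬Adj⇒false (λ xz₂ → none (z₂ , uz₂ , xz₂ , Cz₂≡γ))))
        (¬Adj⇒false (λ up → none (p , up , xp , Cp≡γ)))
        (sameColour⇒nonadjacent z₁≢u p≢u (trans Cz₁≡γ (sym Cp≡γ)))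
        (sameColour⇒nonadjacent z₂≢u p≢u (trans Cz₂≡γ (sym Cp≡γ))))

    singletonsSeeRepeatedColours : ∀ x → isR G u C x ≡ true → (i : Fin (length α)) →
                                   Σ (Vertex G) λ z → Adj G u z × Adj G x z × C z ≡ lookup α i
    singletonsSeeRepeatedColours x x∈R i = recolouringFails⇒colouredNeighbour ux γ-repeated recolouring-fails
      where
      ux : Adj G u x
      ux = isR⇒adj x∈R
      γ-repeated : Repeated G u C (lookup α i)
      γ-repeated = Equivalence.to α-repeated (∈-lookup i)
      recolouring-fails : ¬ ProperColoringOn G (Minus G u) k (recolour C x (lookup α i))
      recolouring-fails proper′ = not-k-colourable (absentColour⇒colourable proper′ (neighbour<k ux) Cx-absent)
        where
        Cx-absent : ∀ w → Adj G u w → recolour C x (lookup α i) w ≢ C x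
        Cx-absent w uw with w ≟ x
        ... | yes refl = λ γ≡Cx → isR⇒notRepeated x∈R (subst (Repeated G u C) γ≡Cx γ-repeated)
        ... | no w≢x   = isR⇒colourUnique x∈R uw w≢x

    laterRepeatedColoursSeen : ∀ y → Adj G u y → (i j : Fin (length α)) → C y ≡ lookup α i → i Fin.< j →
                               Σ (Vertex G) λ z → Adj G u z × Adj G y z × C z ≡ lookup α j
    laterRepeatedColoursSeen y uy i j Cy≡αi i<j =
      recolouringFails⇒colouredNeighbour uy (Equivalence.to α-repeated (∈-lookup j)) recolouring-fails
      where
      recolouring-fails : ¬ ProperColoringOn G (Minus G u) k (recolour C y (lookup α j))
      recolouring-fails proper′ with α′ , triple′ , better′ ← Improvement.better uy Cy≡αi i<j proper′ =
        proj₂ optimal u _ α′ triple′ better′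

mainTheorem1 : (G : Graph) → Critical G → ChairFree G →
    (χ : ℕ) → ChromaticNumber G χ →
    (u : Vertex G) (C : Vertex G → ℕ) (α : List ℕ) →
    Optimal G (χ ∸ 1) u C α →
    (length α ≡ χ ∸ (sizeR G u C + 1)) ×
    (∀ x → isR G u C x ≡ true → (i : Fin (length α)) →
      Σ (Vertex G) λ z → Adj G u z × Adj G x z × C z ≡ lookup α i) ×
    (∀ y → Adj G u y → isR G u C y ≡ false → (i k : Fin (length α)) →
      C y ≡ lookup α i → Data.Fin._<_ i k →
      Σ (Vertex G) λ z → Adj G u z × Adj G y z × C z ≡ lookup α k)
mainTheorem1 G _ chair-free χ χ-chromatic u C α optimal =
  length-α ,
  singletonsSeeRepeatedColours chair-free ,
  λ y uy _ → laterRepeatedColoursSeen chair-free y uy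
  where open OptimalTriple G χ χ-chromatic u C α optimal
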